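{- Let $r\ge3$ and $1\le t\le r-2$ be integers, and let $n\ge 2$ with $X_\ell=\{1,\dots,n\}$ for all $1\le\ell\le r$. Let $\mathcal{F}\subseteq X_1\times\dots\times X_r$ be $t$-intersecting with $|\bigcap\mathcal{F}|<t$, such that for every $1\le\ell\le r$, $\mathcal{F}$ is either $\ell$-shifted or $\ell$-shift-resistant, and such that $\mathcal{F}$ is not coordinate-wise shifted. Then $$|\mathcal{F}|\le (t+2)n^{r-t-1}-(t+1)n^{r-t-2}.$$
   Context: For $A\in X_1\times\dots\times X_r$, $A[\ell]$ is its $\ell$-th coordinate; $A\cap B=\{\ell: A[\ell]=B[\ell]\}$. $\mathcal{F}$ is $t$-intersecting if $|A\cap B|\ge t$ for all $A,B\in\mathcal{F}$; $\bigcap\mathcal{F}$ is the set of $\ell\in[r]$ such that all members of $\mathcal{F}$ have the same $\ell$-th coordinate. Shifts: for $\ell\in[r]$ and $1<j\le n$, given $\mathcal{F}$, for $A\in\mathcal{F}$ let $A'$ be $A$ with its $\ell$-th coordinate replaced by $1$; $S^{(\ell)}_j(A)=A'$ if $A[\ell]=j$ and $A'\notin\mathcal{F}$, else $S^{(\ell)}_j(A)=A$; $S^{(\ell)}_j(\mathcal{F})=\{S^{(\ell)}_j(A):A\in\mathcal{F}\}$. $\mathcal{F}$ is $\ell$-shifted if $S^{(\ell)}_j(\mathcal{F})=\mathcal{F}$ for all $1<j\le n$, and coordinate-wise shifted if it is $\ell$-shifted for every $\ell$. A $t$-intersecting $\mathcal{F}$ with $|\bigcap\mathcal{F}|<t$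 is $\ell$-shift-resistant if there exists $x\in X_\ell$, $x\ne1$, with $|\bigcap S^{(\ell)}_x(\mathcal{F})|=t$. -}

module Defs where

open import Data.Nat using (ℕ; zero; suc)
open import Data.Fin using (Fin; zero; suc; _≟_)
open import Data.Vec using (Vec; lookup; _[_]≔_)
open import Data.Vec.Properties using (≡-dec)
open import Data.List using (List; map; filter; length; allFin)
open import Data.List.Relation.Unary.All using (All; all?)
open import Data.List.Membership.Propositional using (_∈_)
open import Data.Product using (Σ; _×_)
open import Relation.Nullary using (Dec; yes; no; ¬_)
open import Relation.Binary.PropositionalEquality using (_≡_; _≢_)
open import Relation.Binary using (DecidableEquality)
import Data.List.Membership.DecPropositional as DecMem

-- Ground sets X_ℓ = {1,…,n} with n = suc k, encoded as Fin (suc k);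
-- the element "1" is  zero : Fin (suc k).
-- A family 𝓕 is a duplicate-free list of such vectors; |𝓕| = length.

Word : ℕ → ℕ → Set
Word k r = Vec (Fin (suc k)) r

_≟W_ : ∀ {k r} → DecidableEquality (Word k r)
_≟W_ = ≡-dec _≟_

module _ {k r : ℕ} where
  open DecMem (_≟W_ {k} {r}) using (_∈?_)

  inter : Word k r → Word k r → ℕ
  inter A B = length (filter (λ ℓ → lookup A ℓ ≟ lookup B ℓ) (allFin r))

  TIntersecting : ℕ → List (Word k r) → Set
  TIntersecting t F = ∀ {A B} → A ∈ F → B ∈ F → t Data.Nat.≤ inter A B

  common? : (F : List (Word k r)) (ℓ : Fin r) →
            Dec (All (λ A → All (λ B → lookup A ℓ ≡ lookup B ℓ) F) F)
  common? F ℓ = all? (λ A → all? (λ B → lookup A ℓ ≟ lookup B ℓ) F) F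

  coreSize : List (Word k r) → ℕ
  coreSize F = length (filter (common? F) (allFin r))

  shiftElt : List (Word k r) → Fin r → Fin (suc k) → Word k r → Word k r
  shiftElt F ℓ j A with lookup A ℓ ≟ j | (A [ ℓ ]≔ zero) ∈? F
  ... | yes _ | no _ = A [ ℓ ]≔ zero
  ... | _     | _    = A

  shiftFam : List (Word k r) → Fin r → Fin (suc k) → List (Word k r)
  shiftFam F ℓ j = map (shiftElt F ℓ j) F

  SameSet : List (Word k r) → List (Word k r) → Set
  SameSet F G = ∀ A → (A ∈ F → A ∈ G) × (A ∈ G → A ∈ F)

  LShifted : List (Word k r) → Fin r → Set
  LShifted F ℓ = ∀ (j : Fin (suc k)) → j ≢ zero → SameSet (shiftFam F ℓ j) F

  CoordShifted : List (Word k r) → Set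
  CoordShifted F = ∀ (ℓ : Fin r) → LShifted F ℓ

  -- 𝓕 is ℓ-shift-resistant (t-intersecting and |⋂𝓕| < t are assumed
  -- separately in the statement): ∃ x ≠ 1 with |⋂ S^{(ℓ)}_x(𝓕)| = t
  LShiftResistant : ℕ → List (Word k r) → Fin r → Set
  LShiftResistant t F ℓ =
    Σ (Fin (suc k)) λ x → (x ≢ zero) × (coreSize (shiftFam F ℓ x) ≡ t)

{-# OPTIONS --safe #-}

-- Write 1 for the least letter zero. A shift S^(ℓ)_x changes only the ℓ-th coordinate, so if it
-- enlarges the kernel ⋂𝓕 the new common coordinate is ℓ, with common value 1. Hence every A ∈ 𝓕
-- has A[ℓ] = 1, or A[ℓ] = x and A with its ℓ-th coordinate reset to 1 is not in 𝓕. If all other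
-- coordinates were shifted, 𝓕 would be closed under resetting them to 1; doing so in a word with
-- A[ℓ] = x and in one with A[ℓ] = 1 contradicts the above. So, 𝓕 not being coordinate-wise shifted,
-- there are two resistant coordinates ℓ₀ ≠ ℓ₁. Resetting the ℓ₁-th coordinate to 1 is injective on
-- 𝓕, and on each class A[ℓ₀] = 1, A[ℓ₀] = x the images agree on ⋂S^(ℓ₀)_x(𝓕) ∪ {ℓ₁}, a set of
-- t + 1 coordinates (𝓕 is not constant at ℓ₁). Hence |𝓕| ≤ 2nʳ⁻ᵗ⁻¹, which is at most the claimed
-- bound as n ≥ 2 and t ≥ 1.

module Submission where

open import Defs
open import Data.Nat using (ℕ; zero; suc; _+_; _*_; _∸_; _^_; _≤_; _<_; z≤n; s≤s)
open import Data.Nat.Properties hiding (_≟_)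
open import Data.Fin using (Fin; zero; suc; _≟_)
open import Data.Fin.Properties using (∀-cons; ∃-there)
open import Data.Vec using (Vec; []; _∷_; lookup; tail; replicate; _[_]≔_)
open import Data.Vec.Properties using (lookup∘update; lookup∘update′; lookup-replicate; updateAt-id-local; []≔-idempotent; []≔-lookup)
open import Data.Vec.Relation.Binary.Pointwise.Extensional using (ext; Pointwise-≡⇒≡)
open import Data.List using (List; []; _∷_; map; filter; length; allFin; tabulate)
open import Data.List.Properties using (length-map; length-tabulate; length-filter; filter-accept; filter-reject; map-tabulate)
open import Data.List.Relation.Unary.All as All using (All; _∷_)
import Data.List.Relation.Unary.All.Properties as All
open import Data.List.Relation.Unary.Any using (here; there)
open import Data.List.Relation.Unary.AllPairs using ([]; _∷_)
open import Data.List.Relation.Unary.Unique.Propositional using (Unique)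
import Data.List.Relation.Unary.Unique.Propositional.Properties as Unique
open import Data.List.Membership.Propositional using (_∈_; _∉_)
open import Data.List.Membership.Propositional.Properties using (∈-map⁺; ∈-map⁻; ∈-filter⁺; ∈-filter⁻; ∈-allFin)
open import Data.List.Relation.Binary.Subset.Propositional using (_⊆_)
open import Data.List.Relation.Binary.Subset.Propositional.Properties using (filter-⊆)
import Data.List.Relation.Binary.Sublist.Propositional as Sublist
import Data.List.Relation.Binary.Sublist.Propositional.Properties as Sublistₚ
open import Data.Product using (∃; _×_; _,_; proj₁; proj₂)
open import Data.Sum using (_⊎_; inj₁; inj₂; map₁)
open import Data.Empty using (⊥; ⊥-elim)
open import Function using (id; _∘_; flip)
open import Relation.Nullary using (Dec; yes; no; ¬_; contradiction)
open import Relation.Nullary.Decidable using (_⊎-dec_)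
open import Relation.Unary using (Decidable)
open import Relation.Unary.Properties using (∁?)
open import Relation.Binary using (DecidableEquality)
open import Relation.Binary.PropositionalEquality
import Data.List.Membership.DecPropositional as DecMembership

module _ {A B : Set} where

  map⁺-injectiveOn : (f : A → B) {xs : List A} →
                     (∀ {x y} → x ∈ xs → y ∈ xs → f x ≡ f y → x ≡ y) →
                     Unique xs → Unique (map f xs)
  map⁺-injectiveOn f inj [] = []
  map⁺-injectiveOn f inj (x≢xs ∷ u) =
    All.map⁺ (All.tabulate λ y∈ fx≡fy → All.lookup x≢xs y∈ (inj (here refl) (there y∈) fx≡fy))
    ∷ map⁺-injectiveOn f (λ x∈ y∈ → inj (there x∈) (there y∈)) u

  length-filter-map : (f : A → B) {P : B → Set} (P? : Decidable P) (xs : List A) →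
                      length (filter P? (map f xs)) ≡ length (filter (P? ∘ f) xs)
  length-filter-map f P? [] = refl
  length-filter-map f P? (x ∷ xs) with P? (f x)
  ... | yes _ = cong suc (length-filter-map f P? xs)
  ... | no  _ = length-filter-map f P? xs

module _ {A : Set} {P : A → Set} (P? : Decidable P) where

  length-filter+filter∁ : (xs : List A) →
                          length (filter P? xs) + length (filter (∁? P?) xs) ≡ length xs
  length-filter+filter∁ [] = refl
  length-filter+filter∁ (x ∷ xs) with P? x
  ... | yes _ = cong suc (length-filter+filter∁ xs)
  ... | no  _ = trans (+-suc _ _) (cong suc (length-filter+filter∁ xs))

  module _ {Q : A → Set} (Q? : Decidable Q) (P⊆Q : ∀ {x} → P x → Q x) where

    length-filter-mono : (xs : List A) → length (filter P? xs) ≤ length (filter Q? xs)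
    length-filter-mono xs =
      Sublistₚ.length-mono-≤ (Sublistₚ.filter⁺ P? Q? (λ { refl → P⊆Q }) (Sublist.⊆-refl {x = xs}))

    length-filter-mono-< : ∀ {x xs} → x ∈ xs → ¬ P x → Q x →
                           length (filter P? xs) < length (filter Q? xs)
    length-filter-mono-< {x} {_ ∷ xs} (here refl) ¬Px Qx
      rewrite filter-reject P? {x} {xs} ¬Px | filter-accept Q? {x} {xs} Qx =
      s≤s (length-filter-mono xs)
    length-filter-mono-< {_} {y ∷ _} (there x∈) ¬Px Qx with P? y | Q? y
    ... | yes _ | yes _  = s≤s (length-filter-mono-< x∈ ¬Px Qx)
    ... | yes Py | no ¬Qy = contradiction (P⊆Q Py) ¬Qy
    ... | no _  | yes _  = m≤n⇒m≤1+n (length-filter-mono-< x∈ ¬Px Qx)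
    ... | no _  | no _   = length-filter-mono-< x∈ ¬Px Qx

module _ {A B : Set} (_≟ᴮ_ : DecidableEquality B) (f : A → B) where

  fibre : B → List A → List A
  fibre b = filter (λ a → f a ≟ᴮ b)

  ∈-fibre⁻ : ∀ {b xs a} → a ∈ fibre b xs → a ∈ xs × f a ≡ b
  ∈-fibre⁻ {b} {xs} = ∈-filter⁻ (λ a → f a ≟ᴮ b) {xs = xs}

  length-≤-*-fibres : ∀ {m} (bs : List B) {xs : List A} →
                      (∀ {a} → a ∈ xs → f a ∈ bs) →
                      (∀ b → length (fibre b xs) ≤ m) →
                      length xs ≤ length bs * m
  length-≤-*-fibres []       {[]}    _    _     = z≤n
  length-≤-*-fibres []       {_ ∷ _} f∈bs _     = contradiction (f∈bs (here refl)) λ ()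
  length-≤-*-fibres {m} (b ∷ bs) {xs} f∈bs bound = begin
    length xs                         ≡⟨ length-filter+filter∁ b? xs ⟨
    length (fibre b xs) + length rest ≤⟨ +-mono-≤ (bound b) (length-≤-*-fibres bs f∈bs′ bound′) ⟩
    m + length bs * m                 ∎
    where
    open ≤-Reasoning
    b? = λ a → f a ≟ᴮ b
    rest = filter (∁? b?) xs
    f∈bs′ : ∀ {a} → a ∈ rest → f a ∈ bs
    f∈bs′ a∈ with ∈-filter⁻ (∁? b?) a∈
    ... | a∈xs , fa≢b with f∈bs a∈xs
    ...   | here fa≡b = contradiction fa≡b fa≢b
    ...   | there fa∈bs = fa∈bs
    bound′ : ∀ c → length (fibre c rest) ≤ m
    bound′ c = ≤-trans (Sublistₚ.length-mono-≤ (Sublistₚ.filter⁺ c? c? (λ { refl → id })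
                                                  (Sublistₚ.filter-⊆ (∁? b?) xs)))
                       (bound c)
      where c? = λ a → f a ≟ᴮ c

Π⊎∃ : ∀ {r} {P Q : Fin r → Set} → (∀ i → P i ⊎ Q i) → (∀ i → P i) ⊎ ∃ Q
Π⊎∃ {zero}  _ = inj₁ λ ()
Π⊎∃ {suc r} h with h zero | Π⊎∃ (h ∘ suc)
... | inj₂ Q0 | _        = inj₂ (zero , Q0)
... | inj₁ P0 | inj₁ Ps  = inj₁ (∀-cons P0 Ps)
... | inj₁ _  | inj₂ ∃Qs = inj₂ (∃-there ∃Qs)

Π⊎∃-≢ : ∀ {r} {P Q : Fin r → Set} (ℓ₀ : Fin r) → (∀ ℓ → P ℓ ⊎ Q ℓ) →
        (∀ ℓ → ℓ ≢ ℓ₀ → P ℓ) ⊎ ∃ λ ℓ → ℓ ≢ ℓ₀ × Q ℓ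
Π⊎∃-≢ {P = P} {Q} ℓ₀ h = Π⊎∃ away-from-ℓ₀
  where
  away-from-ℓ₀ : ∀ ℓ → (ℓ ≢ ℓ₀ → P ℓ) ⊎ (ℓ ≢ ℓ₀ × Q ℓ)
  away-from-ℓ₀ ℓ with ℓ ≟ ℓ₀ | h ℓ
  ... | yes ℓ≡ℓ₀ | _      = inj₁ (contradiction ℓ≡ℓ₀)
  ... | no _     | inj₁ p = inj₁ (λ _ → p)
  ... | no ℓ≢ℓ₀  | inj₂ q = inj₂ (ℓ≢ℓ₀ , q)

2*^≤ : ∀ {n s t} → 2 ≤ n → 1 ≤ t → 2 ≤ s →
       2 * n ^ (s ∸ 1) ≤ (t + 2) * n ^ (s ∸ 1) ∸ (t + 1) * n ^ (s ∸ 2)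
2*^≤ {n} {suc (suc e)} {t} 2≤n 1≤t (s≤s (s≤s z≤n)) = m+n≤o⇒m≤o∸n (2 * n ^ suc e) (begin
  2 * n ^ suc e + (t + 1) * n ^ e  ≤⟨ +-monoʳ-≤ (2 * n ^ suc e) (*-monoˡ-≤ (n ^ e) t+1≤t*n) ⟩
  2 * n ^ suc e + t * n * n ^ e    ≡⟨ cong (2 * n ^ suc e +_) (*-assoc t n (n ^ e)) ⟩
  2 * n ^ suc e + t * n ^ suc e    ≡⟨ *-distribʳ-+ (n ^ suc e) 2 t ⟨
  (2 + t) * n ^ suc e              ≡⟨ cong (_* n ^ suc e) (+-comm 2 t) ⟩
  (t + 2) * n ^ suc e              ∎)
  where
  open ≤-Reasoning
  t+1≤t*n : t + 1 ≤ t * n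
  t+1≤t*n = begin
    t + 1  ≤⟨ +-monoʳ-≤ t 1≤t ⟩
    t + t  ≡⟨ cong (t +_) (+-identityʳ t) ⟨
    2 * t  ≡⟨ *-comm 2 t ⟩
    t * 2  ≤⟨ *-monoʳ-≤ t 2≤n ⟩
    t * n  ∎

module _ {A : Set} {r : ℕ} where

  ConstantAt : List (Vec A r) → Fin r → Set
  ConstantAt xs i = ∀ {a b} → a ∈ xs → b ∈ xs → lookup a i ≡ lookup b i

  ConstantAt-⊆ : ∀ {xs ys i} → ys ⊆ xs → ConstantAt xs i → ConstantAt ys i
  ConstantAt-⊆ ys⊆xs c a∈ b∈ = c (ys⊆xs a∈) (ys⊆xs b∈)

  all²⇒constantAt : ∀ {xs i} → All (λ a → All (λ b → lookup a i ≡ lookup b i) xs) xs →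
                    ConstantAt xs i
  all²⇒constantAt all² a∈ b∈ = All.lookup (All.lookup all² a∈) b∈

  constantAt⇒all² : ∀ {xs i} → ConstantAt xs i →
                    All (λ a → All (λ b → lookup a i ≡ lookup b i) xs) xs
  constantAt⇒all² c = All.tabulate λ a∈ → All.tabulate λ b∈ → c a∈ b∈

  constantAt-fibre : ∀ (_≟ᴬ_ : DecidableEquality A) i v xs →
                     ConstantAt (fibre _≟ᴬ_ (flip lookup i) v xs) i
  constantAt-fibre _≟ᴬ_ i v xs a∈ b∈ =
    trans (proj₂ (fibre⁻ a∈)) (sym (proj₂ (fibre⁻ b∈)))
    where fibre⁻ = ∈-fibre⁻ _≟ᴬ_ (flip lookup i) {v} {xs}

  constantAt-map-[]≔ : ∀ {xs i} j z → ConstantAt xs i ⊎ i ≡ j →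
                       ConstantAt (map (_[ j ]≔ z) xs) i
  constantAt-map-[]≔ {i = i} j z c a∈ b∈ with ∈-map⁻ (_[ j ]≔ z) a∈ | ∈-map⁻ (_[ j ]≔ z) b∈ | i ≟ j
  ... | a , _ , refl | b , _ , refl | yes refl =
    trans (lookup∘update i a z) (sym (lookup∘update i b z))
  ... | a , a∈ , refl | b , b∈ , refl | no i≢j with c
  ...   | inj₁ cᵢ = trans (lookup∘update′ i≢j a z) (trans (cᵢ a∈ b∈) (sym (lookup∘update′ i≢j b z)))
  ...   | inj₂ i≡j = contradiction i≡j i≢j

count : ∀ {r} {P : Fin r → Set} → Decidable P → ℕ
count {r} P? = length (filter P? (allFin r))

module _ {r : ℕ} {P : Fin (suc r) → Set} (P? : Decidable P) where

  private
    count-∘suc : length (filter P? (tabulate suc)) ≡ count (P? ∘ suc)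
    count-∘suc = trans (cong (length ∘ filter P?) (sym (map-tabulate id suc)))
                       (length-filter-map suc P? (allFin r))

  count-accept : P zero → count P? ≡ suc (count (P? ∘ suc))
  count-accept P0 = trans (cong length (filter-accept P? P0)) (cong suc count-∘suc)

  count-reject : ¬ P zero → count P? ≡ count (P? ∘ suc)
  count-reject ¬P0 = trans (cong length (filter-reject P? ¬P0)) count-∘suc

count≤ : ∀ {r} {P : Fin r → Set} (P? : Decidable P) → count P? ≤ r
count≤ {r} P? = ≤-trans (length-filter P? (allFin r)) (≤-reflexive (length-tabulate id))

module _ {A : Set} {r : ℕ} {xs : List (Vec A (suc r))} where

  unique-map-tail : ConstantAt xs zero → Unique xs → Unique (map tail xs)
  unique-map-tail c = map⁺-injectiveOn tail tail-injectiveOn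
    where
    tail-injectiveOn : ∀ {a b} → a ∈ xs → b ∈ xs → tail a ≡ tail b → a ≡ b
    tail-injectiveOn {_ ∷ _} {_ ∷ _} a∈ b∈ = cong₂ _∷_ (c a∈ b∈)

  constantAt-map-tail : ∀ {i} → ConstantAt xs (suc i) → ConstantAt (map tail xs) i
  constantAt-map-tail c a∈ b∈ with ∈-map⁻ tail a∈ | ∈-map⁻ tail b∈
  ... | _ ∷ _ , a∈xs , refl | _ ∷ _ , b∈xs , refl = c a∈xs b∈xs

module _ {n : ℕ} where

  length-≤-^-constantAt : ∀ {r} {P : Fin r → Set} (P? : Decidable P) {xs : List (Vec (Fin n) r)} →
                          Unique xs → (∀ {i} → P i → ConstantAt xs i) →
                          length xs ≤ n ^ (r ∸ count P?)

  length-≤-^-constantAt-head : ∀ {r} {P : Fin (suc r) → Set} (P? : Decidable P)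
                               {xs : List (Vec (Fin n) (suc r))} →
                               Unique xs → ConstantAt xs zero →
                               (∀ {i} → P (suc i) → ConstantAt xs (suc i)) →
                               length xs ≤ n ^ (r ∸ count (P? ∘ suc))
  length-≤-^-constantAt-head P? {xs} u c₀ c =
    subst (_≤ _) (length-map tail xs)
      (length-≤-^-constantAt (P? ∘ suc) (unique-map-tail c₀ u) (constantAt-map-tail ∘ c))

  length-≤-^-constantAt {zero}  P? {[]}              _                 _ = z≤n
  length-≤-^-constantAt {zero}  P? {[] ∷ []}         _                 _ = ≤-refl
  length-≤-^-constantAt {zero}  P? {[] ∷ [] ∷ _}     ((≢[] ∷ _) ∷ _)   _ = contradiction refl ≢[]
  length-≤-^-constantAt {suc r} {P} P? {xs} u c = by-cases (P? zero)
    where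
    open ≤-Reasoning
    P?∘suc = P? ∘ suc
    head = flip lookup zero
    fibre-bound : ∀ v → length (fibre _≟_ head v xs) ≤ n ^ (r ∸ count P?∘suc)
    fibre-bound v = length-≤-^-constantAt-head P? (Unique.filter⁺ (λ a → head a ≟ v) u)
                      (constantAt-fibre _≟_ zero v xs) (ConstantAt-⊆ (filter-⊆ _ xs) ∘ c)
    by-cases : Dec (P zero) → length xs ≤ n ^ (suc r ∸ count P?)
    by-cases (yes P0) = subst (λ m → length xs ≤ n ^ (suc r ∸ m)) (sym (count-accept P? P0))
                          (length-≤-^-constantAt-head P? u (c P0) c)
    by-cases (no ¬P0) = begin
      length xs
        ≤⟨ length-≤-*-fibres _≟_ head (allFin n) {xs} (λ {a} _ → ∈-allFin (head a)) fibre-bound ⟩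
      length (allFin n) * n ^ (r ∸ count P?∘suc)
        ≡⟨ cong (_* n ^ (r ∸ count P?∘suc)) (length-tabulate {n = n} id) ⟩
      n ^ suc (r ∸ count P?∘suc)                 ≡⟨ cong (n ^_) (+-∸-assoc 1 (count≤ P?∘suc)) ⟨
      n ^ (suc r ∸ count P?∘suc)                 ≡⟨ cong (λ m → n ^ (suc r ∸ m)) (count-reject P? ¬P0) ⟨
      n ^ (suc r ∸ count P?)                     ∎

module _ {A : Set} {r : ℕ} where

  []≔-injective : ∀ {a b : Vec A r} i {z} → a [ i ]≔ z ≡ b [ i ]≔ z → lookup a i ≡ lookup b i → a ≡ b
  []≔-injective {a} {b} i {z} a′≡b′ aᵢ≡bᵢ = begin
    a                          ≡⟨ restore a ⟨
    (a [ i ]≔ z) [ i ]≔ lookup a i ≡⟨ cong₂ (λ c w → c [ i ]≔ w) a′≡b′ aᵢ≡bᵢ ⟩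
    (b [ i ]≔ z) [ i ]≔ lookup b i ≡⟨ restore b ⟩
    b                          ∎
    where
    open ≡-Reasoning
    restore : ∀ c → (c [ i ]≔ z) [ i ]≔ lookup c i ≡ c
    restore c = trans ([]≔-idempotent c i) ([]≔-lookup c i)

  _[_]≔*_ : Vec A r → List (Fin r) → A → Vec A r
  a [ []     ]≔* z = a
  a [ i ∷ is ]≔* z = (a [ is ]≔* z) [ i ]≔ z

  lookup∘update*-∉ : ∀ {a j is z} → j ∉ is → lookup (a [ is ]≔* z) j ≡ lookup a j
  lookup∘update*-∉ {is = []}     _   = refl
  lookup∘update*-∉ {a} {is = i ∷ is} {z} j∉ =
    trans (lookup∘update′ (j∉ ∘ here) (a [ is ]≔* z) z) (lookup∘update*-∉ (j∉ ∘ there))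

  lookup∘update*-∈ : ∀ {a j is z} → j ∈ is → lookup (a [ is ]≔* z) j ≡ z
  lookup∘update*-∈ {a} {j} {i ∷ is} {z} j∈ with j ≟ i | j∈
  ... | yes refl | _         = lookup∘update i (a [ is ]≔* z) z
  ... | no j≢i   | here j≡i  = contradiction j≡i j≢i
  ... | no j≢i   | there j∈′ = trans (lookup∘update′ j≢i (a [ is ]≔* z) z) (lookup∘update*-∈ j∈′)

  update*-complete : ∀ {a is z} → (∀ j → j ∈ is) → a [ is ]≔* z ≡ replicate r z
  update*-complete {z = z} every =
    Pointwise-≡⇒≡ (ext λ j → trans (lookup∘update*-∈ (every j)) (sym (lookup-replicate j z)))

  update*-closed : ∀ {F : List (Vec A r)} {is z} → (∀ {i a} → i ∈ is → a ∈ F → a [ i ]≔ z ∈ F) →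
                   ∀ {a} → a ∈ F → a [ is ]≔* z ∈ F
  update*-closed {is = []}     closed a∈ = a∈
  update*-closed {is = i ∷ is} closed a∈ = closed (here refl) (update*-closed (closed ∘ there) a∈)

module _ {k r : ℕ} where
  open DecMembership (_≟W_ {k} {r}) using (_∈?_)

  shiftElt-spec : ∀ F ℓ j (A : Word k r) →
                  (lookup A ℓ ≡ j × A [ ℓ ]≔ zero ∉ F × shiftElt F ℓ j A ≡ A [ ℓ ]≔ zero) ⊎
                  (shiftElt F ℓ j A ≡ A × (lookup A ℓ ≡ j → A [ ℓ ]≔ zero ∈ F))
  shiftElt-spec F ℓ j A with lookup A ℓ ≟ j | A [ ℓ ]≔ zero ∈? F
  ... | yes Aℓ≡j | no A′∉F  = inj₁ (Aℓ≡j , A′∉F , refl)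
  ... | yes _    | yes A′∈F = inj₂ (refl , λ _ → A′∈F)
  ... | no Aℓ≢j  | _        = inj₂ (refl , λ Aℓ≡j → contradiction Aℓ≡j Aℓ≢j)

  lookup-shiftElt-≢ : ∀ F ℓ j A {i} → i ≢ ℓ → lookup (shiftElt F ℓ j A) i ≡ lookup A i
  lookup-shiftElt-≢ F ℓ j A {i} i≢ℓ with shiftElt-spec F ℓ j A
  ... | inj₁ (_ , _ , sA≡A′) = trans (cong (flip lookup i) sA≡A′) (lookup∘update′ i≢ℓ A zero)
  ... | inj₂ (sA≡A , _)      = cong (flip lookup i) sA≡A

  LShifted⇒[]≔zero∈ : ∀ {F ℓ} → LShifted F ℓ → ∀ {A} → A ∈ F → A [ ℓ ]≔ zero ∈ F
  LShifted⇒[]≔zero∈ {F} {ℓ} shifted {A} A∈F with lookup A ℓ ≟ zero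
  ... | yes Aℓ≡0 = subst (_∈ F) (sym (updateAt-id-local ℓ A (sym Aℓ≡0))) A∈F
  ... | no Aℓ≢0 with shiftElt-spec F ℓ (lookup A ℓ) A
  ...   | inj₁ (_ , _ , sA≡A′) = subst (_∈ F) sA≡A′ sA∈F
    where
    sA∈F : shiftElt F ℓ (lookup A ℓ) A ∈ F
    sA∈F = proj₁ (shifted (lookup A ℓ) Aℓ≢0 _) (∈-map⁺ _ A∈F)
  ...   | inj₂ (_ , A′∈F)      = A′∈F refl

  constantAt-shiftFam : ∀ {F ℓ j i} → i ≢ ℓ → ConstantAt (shiftFam F ℓ j) i → ConstantAt F i
  constantAt-shiftFam {F} {ℓ} {j} {i} i≢ℓ c {a} {b} a∈ b∈ = begin
    lookup a i     ≡⟨ lookup-shiftElt-≢ F ℓ j a i≢ℓ ⟨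
    lookup (s a) i ≡⟨ c (∈-map⁺ s a∈) (∈-map⁺ s b∈) ⟩
    lookup (s b) i ≡⟨ lookup-shiftElt-≢ F ℓ j b i≢ℓ ⟩
    lookup b i     ∎
    where
    open ≡-Reasoning
    s = shiftElt F ℓ j

  coreSize-shiftFam-≤ : ∀ {F ℓ j} → (ConstantAt (shiftFam F ℓ j) ℓ → ConstantAt F ℓ) →
                        coreSize (shiftFam F ℓ j) ≤ coreSize F
  coreSize-shiftFam-≤ {F} {ℓ} {j} h =
    length-filter-mono (common? G) (common? F) (constantAt⇒all² ∘ stays ∘ all²⇒constantAt) (allFin r)
    where
    G = shiftFam F ℓ j
    stays : ∀ {i} → ConstantAt G i → ConstantAt F i
    stays {i} with i ≟ ℓ
    ... | yes refl = h
    ... | no i≢ℓ   = constantAt-shiftFam i≢ℓ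

  module EnlargingShift {F : List (Word k r)} {ℓ : Fin r} {x : Fin (suc k)}
                        (enlarges : coreSize F < coreSize (shiftFam F ℓ x)) where

    private
      G = shiftFam F ℓ x
      s = shiftElt F ℓ x

    enters-core : ConstantAt G ℓ × ¬ ConstantAt F ℓ
    enters-core with common? F ℓ | common? G ℓ
    ... | yes cF  | _      = contradiction (coreSize-shiftFam-≤ λ _ → all²⇒constantAt cF) (<⇒≱ enlarges)
    ... | no _    | no ¬cG = contradiction (coreSize-shiftFam-≤ λ cG → contradiction (constantAt⇒all² cG) ¬cG)
                                           (<⇒≱ enlarges)
    ... | no ¬cF  | yes cG = all²⇒constantAt cG , ¬cF ∘ constantAt⇒all²

    lookup-shiftElt-ℓ : ∀ {A} → A ∈ F → lookup (s A) ℓ ≡ zero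
    lookup-shiftElt-ℓ {A} A∈F with lookup (s A) ℓ ≟ zero
    ... | yes sAℓ≡0 = sAℓ≡0
    ... | no sAℓ≢0  = ⊥-elim (proj₂ enters-core constant)
      where
      open ≡-Reasoning
      -- a word that moved has 1 at ℓ, which is not the common value; so none moved
      unshifted : ∀ {a} → a ∈ F → lookup a ℓ ≡ lookup (s A) ℓ
      unshifted {a} a∈F with shiftElt-spec F ℓ x a
      ... | inj₁ (_ , _ , sa≡a′) = contradiction (begin
        lookup (s A) ℓ            ≡⟨ proj₁ enters-core (∈-map⁺ s A∈F) (∈-map⁺ s a∈F) ⟩
        lookup (s a) ℓ            ≡⟨ cong (flip lookup ℓ) sa≡a′ ⟩
        lookup (a [ ℓ ]≔ zero) ℓ  ≡⟨ lookup∘update ℓ a zero ⟩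
        zero                      ∎) sAℓ≢0
      ... | inj₂ (sa≡a , _) = begin
        lookup a ℓ     ≡⟨ cong (flip lookup ℓ) sa≡a ⟨
        lookup (s a) ℓ ≡⟨ proj₁ enters-core (∈-map⁺ s a∈F) (∈-map⁺ s A∈F) ⟩
        lookup (s A) ℓ ∎
      constant : ConstantAt F ℓ
      constant a∈F b∈F = trans (unshifted a∈F) (sym (unshifted b∈F))

    lookup-cases : ∀ {A} → A ∈ F → lookup A ℓ ≡ zero ⊎ (lookup A ℓ ≡ x × A [ ℓ ]≔ zero ∉ F)
    lookup-cases {A} A∈F with shiftElt-spec F ℓ x A
    ... | inj₁ (Aℓ≡x , A′∉F , _) = inj₂ (Aℓ≡x , A′∉F)
    ... | inj₂ (sA≡A , _)        = inj₁ (trans (cong (flip lookup ℓ) (sym sA≡A)) (lookup-shiftElt-ℓ A∈F))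

    others-not-all-shifted : x ≢ zero → ¬ (∀ i → i ≢ ℓ → LShifted F i)
    others-not-all-shifted x≢0 shifted = proj₂ enters-core constant
      where
      others : List (Fin r)
      others = filter (∁? (_≟ ℓ)) (allFin r)
      every : ∀ j → j ∈ ℓ ∷ others
      every j with j ≟ ℓ
      ... | yes refl = here refl
      ... | no j≢ℓ   = there (∈-filter⁺ (∁? (_≟ ℓ)) (∈-allFin j) j≢ℓ)
      project : Word k r → Word k r
      project A = A [ others ]≔* zero
      project∈ : ∀ {A} → A ∈ F → project A ∈ F
      project∈ = update*-closed λ i∈ →
        LShifted⇒[]≔zero∈ (shifted _ (proj₂ (∈-filter⁻ (∁? (_≟ ℓ)) {xs = allFin r} i∈)))
      lookup-project-ℓ : ∀ {A} → lookup (project A) ℓ ≡ lookup A ℓ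
      lookup-project-ℓ = lookup∘update*-∉ λ ℓ∈ → proj₂ (∈-filter⁻ (∁? (_≟ ℓ)) {xs = allFin r} ℓ∈) refl
      not-x-and-zero : ∀ {a b} → a ∈ F → b ∈ F → lookup a ℓ ≡ x → lookup b ℓ ≡ zero → ⊥
      not-x-and-zero {a} {b} a∈F b∈F aℓ≡x bℓ≡0 with lookup-cases (project∈ a∈F)
      ... | inj₁ paℓ≡0       = x≢0 (trans (sym aℓ≡x) (trans (sym lookup-project-ℓ) paℓ≡0))
      ... | inj₂ (_ , pa′∉F) = pa′∉F (subst (_∈ F) pb≡pa′ (project∈ b∈F))
        where
        open ≡-Reasoning
        pb≡pa′ : project b ≡ project a [ ℓ ]≔ zero
        pb≡pa′ = begin
          project b             ≡⟨ updateAt-id-local ℓ (project b) (sym (trans lookup-project-ℓ bℓ≡0)) ⟨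
          project b [ ℓ ]≔ zero ≡⟨ update*-complete every ⟩
          replicate r zero      ≡⟨ update*-complete every ⟨
          project a [ ℓ ]≔ zero ∎
      constant : ConstantAt F ℓ
      constant a∈F b∈F with lookup-cases a∈F | lookup-cases b∈F
      ... | inj₁ aℓ≡0        | inj₁ bℓ≡0        = trans aℓ≡0 (sym bℓ≡0)
      ... | inj₂ (aℓ≡x , _)  | inj₂ (bℓ≡x , _)  = trans aℓ≡x (sym bℓ≡x)
      ... | inj₂ (aℓ≡x , _)  | inj₁ bℓ≡0        = ⊥-elim (not-x-and-zero a∈F b∈F aℓ≡x bℓ≡0)
      ... | inj₁ aℓ≡0        | inj₂ (bℓ≡x , _)  = ⊥-elim (not-x-and-zero b∈F a∈F bℓ≡x aℓ≡0)

  module TwoEnlargingShifts {F : List (Word k r)} (F-unique : Unique F)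
                            {ℓ₀ x} (enlarges₀ : coreSize F < coreSize (shiftFam F ℓ₀ x))
                            {ℓ₁ y} (enlarges₁ : coreSize F < coreSize (shiftFam F ℓ₁ y))
                            (ℓ₁≢ℓ₀ : ℓ₁ ≢ ℓ₀) where

    private
      G = shiftFam F ℓ₀ x
      module S₀ = EnlargingShift enlarges₀
      module S₁ = EnlargingShift enlarges₁
      n = suc k
      zero₁ : Word k r → Word k r
      zero₁ A = A [ ℓ₁ ]≔ zero
      core∪ℓ₁? = λ i → common? G i ⊎-dec i ≟ ℓ₁
      fibre₀ : Fin n → List (Word k r) → List (Word k r)
      fibre₀ = fibre _≟_ (flip lookup ℓ₀)

    coreSize<count-core∪ℓ₁ : coreSize G < count core∪ℓ₁?
    coreSize<count-core∪ℓ₁ =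
      length-filter-mono-< (common? G) core∪ℓ₁? inj₁ (∈-allFin ℓ₁) ℓ₁∉core (inj₂ refl)
      where
      ℓ₁∉core = λ c → proj₂ S₁.enters-core (constantAt-shiftFam ℓ₁≢ℓ₀ (all²⇒constantAt c))

    zero₁-injectiveOn : ∀ {a b} → a ∈ F → b ∈ F → zero₁ a ≡ zero₁ b → a ≡ b
    zero₁-injectiveOn {a} {b} a∈F b∈F a′≡b′ with S₁.lookup-cases a∈F | S₁.lookup-cases b∈F
    ... | inj₁ aℓ₁≡0       | inj₁ bℓ₁≡0       = []≔-injective ℓ₁ a′≡b′ (trans aℓ₁≡0 (sym bℓ₁≡0))
    ... | inj₂ (aℓ₁≡y , _) | inj₂ (bℓ₁≡y , _) = []≔-injective ℓ₁ a′≡b′ (trans aℓ₁≡y (sym bℓ₁≡y))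
    ... | inj₁ aℓ₁≡0       | inj₂ (_ , b′∉F)  =
      contradiction (subst (_∈ F) (trans (sym (updateAt-id-local ℓ₁ a (sym aℓ₁≡0))) a′≡b′) a∈F) b′∉F
    ... | inj₂ (_ , a′∉F)  | inj₁ bℓ₁≡0       =
      contradiction (subst (_∈ F) (trans (sym (updateAt-id-local ℓ₁ b (sym bℓ₁≡0))) (sym a′≡b′)) b∈F) a′∉F

    length-fibre₀-≤ : ∀ v → length (fibre₀ v F) ≤ n ^ (r ∸ count core∪ℓ₁?)
    length-fibre₀-≤ v = subst (_≤ n ^ (r ∸ count core∪ℓ₁?)) (length-map zero₁ (fibre₀ v F))
      (length-≤-^-constantAt core∪ℓ₁? {map zero₁ (fibre₀ v F)} unique
                             (constantAt-map-[]≔ ℓ₁ zero ∘ map₁ constant))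
      where
      fibre₀-⊆ : fibre₀ v F ⊆ F
      fibre₀-⊆ = filter-⊆ (λ a → lookup a ℓ₀ ≟ v) F
      unique : Unique (map zero₁ (fibre₀ v F))
      unique = map⁺-injectiveOn zero₁ (λ a∈ b∈ → zero₁-injectiveOn (fibre₀-⊆ a∈) (fibre₀-⊆ b∈))
                 (Unique.filter⁺ (λ a → lookup a ℓ₀ ≟ v) F-unique)
      constant : ∀ {i} → All (λ a → All (λ b → lookup a i ≡ lookup b i) G) G → ConstantAt (fibre₀ v F) i
      constant {i} c with i ≟ ℓ₀
      ... | yes refl = constantAt-fibre _≟_ ℓ₀ v F
      ... | no i≢ℓ₀  = ConstantAt-⊆ fibre₀-⊆ (constantAt-shiftFam i≢ℓ₀ (all²⇒constantAt c))

    length-≤-2*^ : length F ≤ 2 * n ^ (r ∸ coreSize G ∸ 1)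
    length-≤-2*^ = begin
      length F                      ≤⟨ length-≤-*-fibres _≟_ (flip lookup ℓ₀) (zero ∷ x ∷ []) {F}
                                                         values length-fibre₀-≤ ⟩
      2 * n ^ (r ∸ count core∪ℓ₁?)  ≤⟨ *-monoʳ-≤ 2 (^-monoʳ-≤ n exponent) ⟩
      2 * n ^ (r ∸ coreSize G ∸ 1)  ∎
      where
      open ≤-Reasoning
      values : ∀ {a} → a ∈ F → lookup a ℓ₀ ∈ zero ∷ x ∷ []
      values a∈F with S₀.lookup-cases a∈F
      ... | inj₁ aℓ₀≡0       = here aℓ₀≡0
      ... | inj₂ (aℓ₀≡x , _) = there (here aℓ₀≡x)
      exponent : r ∸ count core∪ℓ₁? ≤ r ∸ coreSize G ∸ 1
      exponent = ≤-trans (∸-monoʳ-≤ r (≤-trans (≤-reflexive (+-comm (coreSize G) 1)) coreSize<count-core∪ℓ₁))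
                         (≤-reflexive (sym (∸-+-assoc r (coreSize G) 1)))

lemma2p3 : (r t k : ℕ) → 3 ≤ r → 1 ≤ t → t ≤ r ∸ 2 → 1 ≤ k →
    (F : List (Word k r)) → Unique F →
    TIntersecting t F → coreSize F < t →
    (∀ (ℓ : Fin r) → LShifted F ℓ ⊎ LShiftResistant t F ℓ) →
    ¬ CoordShifted F →
    length F ≤ (t + 2) * suc k ^ (r ∸ t ∸ 1) ∸ (t + 1) * suc k ^ (r ∸ t ∸ 2)
lemma2p3 r t k 3≤r 1≤t t≤r∸2 1≤k F F-unique _ core<t shifted-or-resistant ¬shifted
  with Π⊎∃ shifted-or-resistant
... | inj₁ shifted = contradiction shifted ¬shifted
... | inj₂ (ℓ₀ , x , x≢0 , core₀≡t)
  with Π⊎∃-≢ ℓ₀ shifted-or-resistant | subst (coreSize F <_) (sym core₀≡t) core<t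
...   | inj₁ others-shifted | enlarges₀ =
  contradiction others-shifted (EnlargingShift.others-not-all-shifted enlarges₀ x≢0)
...   | inj₂ (ℓ₁ , ℓ₁≢ℓ₀ , y , _ , core₁≡t) | enlarges₀ = begin
  length F                                         ≤⟨ TwoEnlargingShifts.length-≤-2*^ F-unique enlarges₀ enlarges₁ ℓ₁≢ℓ₀ ⟩
  2 * suc k ^ (r ∸ coreSize (shiftFam F ℓ₀ x) ∸ 1) ≡⟨ cong (λ c → 2 * suc k ^ (r ∸ c ∸ 1)) core₀≡t ⟩
  2 * suc k ^ (r ∸ t ∸ 1)                          ≤⟨ 2*^≤ (s≤s 1≤k) 1≤t 2≤r∸t ⟩
  (t + 2) * suc k ^ (r ∸ t ∸ 1) ∸ (t + 1) * suc k ^ (r ∸ t ∸ 2) ∎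
  where
  open ≤-Reasoning
  enlarges₁ : coreSize F < coreSize (shiftFam F ℓ₁ y)
  enlarges₁ = subst (coreSize F <_) (sym core₁≡t) core<t
  2≤r∸t : 2 ≤ r ∸ t
  2≤r∸t = m+n≤o⇒m≤o∸n 2 (≤-trans (≤-reflexive (+-comm 2 t)) (m≤o∸n⇒m+n≤o t (<⇒≤ 3≤r) t≤r∸2))
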